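{- Let $k\ge 3$ and let $F=v_1v_2\cdots v_kv_1$ be a cycle of length $k$. Let $c,u\in\{1,2,3,4\}$ with $c\neq u$. Then there are maps $C:V(F)\to\{1,2,3,4\}$ and $U:V(F)\to\{1,2,3,4\}$ with $C(v_1)=c$ and $U(v_1)=u$ such that: neither neighbor of $v_1$ on $F$ has color $u$; for every vertex $w\neq v_1$ of $F$, $U(w)$ is the color of exactly one neighbor of $w$ on $F$; $C(w)\neq U(w)$ for all $w\in V(F)$; and for every edge $\{x,y\}$ of $F$, $C(x)\neq C(y)$ and $|\{C(x),U(x),C(y),U(y)\}|=3$.
   Context: This formalizes the statement that if one vertex $v_1$ of a face $F$ of an outerplanar graph is already colored with color $c$ and has a uniquely colored neighbor (outside $F$) of color $u\neq c$, then the rest of $F$ can be colored with at most $4$ colors retaining $C(v_1)$ and $U(v_1)$ and satisfying the invariants (unique neighbor color $U(w)\neq C(w)$, proper on edges, and three distinct values among $C,U$ of the endpoints of each edge). -}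

module Defs where

open import Data.Nat using (ℕ; suc; _+_; _≥_; NonZero)
open import Data.Nat.DivMod using (_mod_)
open import Data.Fin using (Fin; toℕ; zero; suc)
open import Data.List using (List; _∷_; []; length; filter)
open import Data.List.Membership.DecPropositional (Data.Fin._≟_ {4}) using (_∈?_)
open import Data.List using (allFin)
open import Data.Product using (_×_)
open import Data.Sum using (_⊎_)
open import Relation.Nullary using (¬_)
open import Relation.Binary.PropositionalEquality using (_≡_; _≢_)

Color : Set
Color = Fin 4

-- Vertices of the cycle F = v_1 v_2 ... v_k v_1 are indexed by Fin k;
-- index i stands for v_{i+1}, so v_1 is index zero.
-- Successor and predecessor on the cycle (indices mod k).
next : {k : ℕ} .{{_ : NonZero k}} → Fin k → Fin k
next {k} i = (toℕ i + 1) mod k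

prev : {k : ℕ} .{{_ : NonZero k}} → Fin k → Fin k
prev {suc k'} i = (toℕ i + k') mod (suc k')

ExactlyOne : Set → Set → Set
ExactlyOne P Q = (P × ¬ Q) ⊎ (¬ P × Q)

distinctCount : List Color → ℕ
distinctCount xs = length (filter (λ x → x ∈? xs) (allFin 4))

GoodColoring : (k : ℕ) .{{_ : NonZero k}} → Color → Color →
               (Fin k → Color) → (Fin k → Color) → Set
GoodColoring k c u C U =
    (C zero' ≡ c) × (U zero' ≡ u)
  × ((C (next zero') ≢ u) × (C (prev zero') ≢ u))
  × ((w : Fin k) → w ≢ zero' → ExactlyOne (C (prev w) ≡ U w) (C (next w) ≡ U w))
  × ((w : Fin k) → C w ≢ U w)
  × ((x : Fin k) → (C x ≢ C (next x))
                   × (distinctCount (C x ∷ U x ∷ C (next x) ∷ U (next x) ∷ []) ≡ 3))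
  where
    zero' : Fin k
    zero' = 0 mod k

module Submission where

-- Read the face F = v_1 … v_k as a closed walk s 0, s 1, …, s k with
-- C(v_{i+1}) = s i and s k = s 0 = c, and give every vertex w ≠ v_1 the colour of its
-- successor as unique colour, U(w) = C(next w).  All requirements then become local
-- conditions on the walk: any two and any three consecutive letters are distinct, the
-- third letter is u and the last-but-one letter is not u (record ClosedWord).  Such a
-- walk is written over the abstract letters 0,1,2,3 (standing for c, u and the two
-- remaining colours): for k = 4 + j it is (0 2 1)^{⌊j/3⌋+1} followed by 3 | 3 2 | 0 2 3
-- and the closing 0.  A relabelling π of the letters with π 0 = c, π 1 = u turns it
-- into an actual walk.  The triangle k = 3 is the one case where no such walk exists
-- (its third letter s 2 would also be the last-but-one); there U(v_2) = C(v_1) instead.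

open import Defs
open import Data.Nat using (ℕ; zero; suc; pred; _+_; _≥_; _<_; NonZero; z≤n; s≤s; _%_)
import Data.Nat as ℕ
open import Data.Nat.Properties using (+-comm; +-suc; suc-injective; ≤-refl; m≤n⇒m<n∨m≡n; m<n⇒m<1+n; <⇒≤)
open import Data.Nat.DivMod using (_mod_; m<n⇒m%n≡m; n%n≡0; [m+n]%n≡m%n)
open import Data.Fin using (Fin; toℕ; zero; suc; #_; _≟_)
open import Data.Fin.Properties using (toℕ<n; toℕ-fromℕ<; all?; any?)
open import Data.List using (List; _∷_; []; length; filter; allFin)
open import Data.List.Properties using (filter-≐)
open import Data.List.Membership.DecPropositional (_≟_ {4}) using (_∈?_)
open import Data.List.Membership.Propositional using (_∈_)
open import Data.List.Relation.Binary.Subset.Propositional using (_⊆_)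
open import Data.List.Relation.Unary.All as All using (All; _∷_; [])
open import Data.List.Relation.Unary.Any using (here; there)
open import Data.Product using (Σ; ∃₂; _×_; _,_; proj₁; proj₂)
open import Data.Unit using (⊤; tt)
open import Data.Sum using (_⊎_; inj₁; inj₂)
open import Data.Empty using (⊥-elim)
open import Function using (_∘_)
open import Relation.Nullary using (Dec; yes)
open import Relation.Nullary.Decidable using (from-yes; ¬?; _×-dec_; _→-dec_)
open import Relation.Binary.PropositionalEquality
  using (_≡_; _≢_; refl; sym; trans; cong; subst; module ≡-Reasoning)
open ≡-Reasoning

Rainbow : {A : Set} → A → A → A → Set
Rainbow x y z = x ≢ y × y ≢ z × x ≢ z

rainbow? : (x y z : Fin 4) → Dec (Rainbow x y z)
rainbow? x y z = ¬? (x ≟ y) ×-dec ¬? (y ≟ z) ×-dec ¬? (x ≟ z)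

distinctCount-cong : {xs ys : List Color} → xs ⊆ ys → ys ⊆ xs →
                     distinctCount xs ≡ distinctCount ys
distinctCount-cong {xs} {ys} xs⊆ys ys⊆xs =
  cong length (filter-≐ (_∈? xs) (_∈? ys) (xs⊆ys , ys⊆xs) (allFin 4))

distinctCount-rainbow : ∀ x y z → Rainbow x y z → distinctCount (x ∷ y ∷ z ∷ []) ≡ 3
distinctCount-rainbow = from-yes (all? λ x → all? λ y → all? λ z →
  rainbow? x y z →-dec distinctCount (x ∷ y ∷ z ∷ []) ℕ.≟ 3)

distinctCount-three : ∀ {x y z : Color} {xs} → Rainbow x y z →
                      All (_∈ x ∷ y ∷ z ∷ []) xs → All (_∈ xs) (x ∷ y ∷ z ∷ []) →
                      distinctCount xs ≡ 3
distinctCount-three {x} {y} {z} xyz xs⊆ xyz⊆ =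
  trans (distinctCount-cong (All.lookup xs⊆) (All.lookup xyz⊆)) (distinctCount-rainbow x y z xyz)

at₀ : ∀ {x : Color} {xs} → x ∈ x ∷ xs
at₀ = here refl

at₁ : ∀ {x y : Color} {xs} → y ∈ x ∷ y ∷ xs
at₁ = there at₀

at₂ : ∀ {x y z : Color} {xs} → z ∈ x ∷ y ∷ z ∷ xs
at₂ = there at₁

at₃ : ∀ {x y z w : Color} {xs} → w ∈ x ∷ y ∷ z ∷ w ∷ xs
at₃ = there at₂

-- The three shapes of the lists {C(x), U(x), C(y), U(y)} met along an edge xy.
module _ {x y z : Color} (xyz : Rainbow x y z) where

  count-xyyz : distinctCount (x ∷ y ∷ y ∷ z ∷ []) ≡ 3
  count-xyyz = distinctCount-three xyz (at₀ ∷ at₁ ∷ at₁ ∷ at₂ ∷ []) (at₀ ∷ at₁ ∷ at₃ ∷ [])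

  count-xyzy : distinctCount (x ∷ y ∷ z ∷ y ∷ []) ≡ 3
  count-xyzy = distinctCount-three xyz (at₀ ∷ at₁ ∷ at₂ ∷ at₁ ∷ []) (at₀ ∷ at₁ ∷ at₂ ∷ [])

  count-xyzx : distinctCount (x ∷ y ∷ z ∷ x ∷ []) ≡ 3
  count-xyzx = distinctCount-three xyz (at₀ ∷ at₁ ∷ at₂ ∷ at₀ ∷ []) (at₀ ∷ at₁ ∷ at₂ ∷ [])

SquareProper : {A : Set} → List A → Set
SquareProper []                   = ⊤
SquareProper (x ∷ [])             = ⊤
SquareProper (x ∷ y ∷ [])         = x ≢ y
SquareProper (x ∷ w@(y ∷ z ∷ _))  = Rainbow x y z × SquareProper w

squareProper? : (w : List (Fin 4)) → Dec (SquareProper w)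
squareProper? []                  = yes tt
squareProper? (x ∷ [])            = yes tt
squareProper? (x ∷ y ∷ [])        = ¬? (x ≟ y)
squareProper? (x ∷ w@(y ∷ z ∷ _)) = rainbow? x y z ×-dec squareProper? w

-- The i-th letter of a word (the letter 0 beyond its end).
_!_ : List (Fin 4) → ℕ → Fin 4
[]       ! _     = zero
(x ∷ _)  ! zero  = x
(_ ∷ xs) ! suc i = xs ! i

adjacent-distinct : ∀ w {i} → SquareProper w → suc i < length w → w ! i ≢ w ! suc i
adjacent-distinct (x ∷ [])              _                (s≤s ())
adjacent-distinct (x ∷ y ∷ [])          {zero}  x≢y      _ = x≢y
adjacent-distinct (x ∷ y ∷ [])          {suc _} _        (s≤s (s≤s ()))
adjacent-distinct (x ∷ y ∷ z ∷ _)       {zero}  (xyz , _) _ = proj₁ xyz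
adjacent-distinct (x ∷ w@(y ∷ z ∷ _))   {suc i} (_ , sp) (s≤s lt) = adjacent-distinct w sp lt

skip-distinct : ∀ w {i} → SquareProper w → suc (suc i) < length w → w ! i ≢ w ! suc (suc i)
skip-distinct (x ∷ y ∷ [])          _                (s≤s (s≤s ()))
skip-distinct (x ∷ y ∷ z ∷ _)       {zero}  (xyz , _) _ = proj₂ (proj₂ xyz)
skip-distinct (x ∷ w@(y ∷ z ∷ _))   {suc i} (_ , sp) (s≤s lt) = skip-distinct w sp lt

toℕ-mod : ∀ m n .{{_ : NonZero n}} → toℕ (m mod n) ≡ m % n
toℕ-mod m n = toℕ-fromℕ< _

toℕ-next : ∀ {n} (x : Fin (suc n)) →
           (toℕ x < n × toℕ (next x) ≡ suc (toℕ x)) ⊎ (toℕ x ≡ n × toℕ (next x) ≡ 0)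
toℕ-next {n} x with m≤n⇒m<n∨m≡n (toℕ<n x)
... | inj₁ (s≤s t<n) = inj₁ (t<n , (begin
  toℕ (next x)         ≡⟨ toℕ-mod (toℕ x + 1) (suc n) ⟩
  (toℕ x + 1) % suc n  ≡⟨ cong (_% suc n) (+-comm (toℕ x) 1) ⟩
  suc (toℕ x) % suc n  ≡⟨ m<n⇒m%n≡m (s≤s t<n) ⟩
  suc (toℕ x)          ∎))
... | inj₂ t+1≡k = inj₂ (suc-injective t+1≡k , (begin
  toℕ (next x)         ≡⟨ toℕ-mod (toℕ x + 1) (suc n) ⟩
  (toℕ x + 1) % suc n  ≡⟨ cong (_% suc n) (trans (+-comm (toℕ x) 1) t+1≡k) ⟩
  suc n % suc n        ≡⟨ n%n≡0 (suc n) ⟩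
  0                    ∎))

toℕ-prev-zero : ∀ {n} → toℕ (prev {suc n} zero) ≡ n
toℕ-prev-zero {n} = trans (toℕ-mod n (suc n)) (m<n⇒m%n≡m ≤-refl)

toℕ-prev-suc : ∀ {n} (y : Fin n) → toℕ (prev {suc n} (suc y)) ≡ toℕ y
toℕ-prev-suc {n} y = begin
  toℕ (prev {suc n} (suc y))  ≡⟨ toℕ-mod (suc (toℕ y) + n) (suc n) ⟩
  (suc (toℕ y) + n) % suc n   ≡⟨ cong (_% suc n) (sym (+-suc (toℕ y) n)) ⟩
  (toℕ y + suc n) % suc n     ≡⟨ [m+n]%n≡m%n (toℕ y) (suc n) ⟩
  toℕ y % suc n               ≡⟨ m<n⇒m%n≡m (m<n⇒m<1+n (toℕ<n y)) ⟩
  toℕ y                       ∎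

record ClosedWord (k : ℕ) (c u : Color) (s : ℕ → Color) : Set where
  field
    starts   : s 0 ≡ c
    closes   : s k ≡ c
    third    : s 2 ≡ u
    penult   : s (pred k) ≢ u
    adjacent : ∀ {i} → i < k → s i ≢ s (suc i)
    skip     : ∀ {i} → suc i < k → s i ≢ s (suc (suc i))

walkColouring : ∀ {k} → (ℕ → Color) → Fin k → Color
walkColouring s x = s (toℕ x)

successorColour : Color → (ℕ → Color) → ℕ → Color
successorColour u s zero    = u
successorColour u s (suc i) = s (suc (suc i))

module FromClosedWord {m : ℕ} {c u : Color} {s : ℕ → Color}
                      (closed : ClosedWord (2 + m) c u s) where
  open ClosedWord closed

  private
    C U : Fin (2 + m) → Color
    C = walkColouring s
    U = successorColour u s ∘ toℕ

  -- Going once around the face returns to s 0 = s k.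
  C-next : (x : Fin (2 + m)) → C (next x) ≡ s (suc (toℕ x))
  C-next x with toℕ-next x
  ... | inj₁ (_ , next≡) = cong s next≡
  ... | inj₂ (x≡last , next≡) = begin
    s (toℕ (next x))   ≡⟨ cong s next≡ ⟩
    s 0                ≡⟨ trans starts (sym closes) ⟩
    s (2 + m)          ≡⟨ cong (s ∘ suc) (sym x≡last) ⟩
    s (suc (toℕ x))    ∎

  -- c = s 0 and u = s 2 are two steps apart on the walk.
  c≢u : c ≢ u
  c≢u c≡u = skip (s≤s (s≤s z≤n)) (trans starts (trans c≡u (sym third)))

  edge-proper : (x : Fin (2 + m)) → C x ≢ C (next x)
  edge-proper x Cx≡ = adjacent (toℕ<n x) (trans Cx≡ (C-next x))

  unique : (w : Fin (2 + m)) → w ≢ zero → ExactlyOne (C (prev w) ≡ U w) (C (next w) ≡ U w)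
  unique zero    w≢0 = ⊥-elim (w≢0 refl)
  unique (suc y) _   = inj₂ (prev≢ , C-next (suc y))
    where
      prev≢ : C (prev (suc y)) ≢ U (suc y)
      prev≢ e = skip (toℕ<n (suc y)) (trans (cong s (sym (toℕ-prev-suc y))) e)

  -- At v_1 this is c ≢ u; elsewhere U w is the colour of the neighbour next w.
  C≢U : (w : Fin (2 + m)) → C w ≢ U w
  C≢U zero    Cw≡ = c≢u (trans (sym starts) Cw≡)
  C≢U (suc y) Cw≡ = edge-proper (suc y) (trans Cw≡ (sym (C-next (suc y))))

  window : ∀ {i} → suc i < 2 + m → Rainbow (s i) (s (suc i)) (s (suc (suc i)))
  window lt = adjacent (<⇒≤ lt) , adjacent lt , skip lt

  count : (x : Fin (2 + m)) → distinctCount (C x ∷ U x ∷ C (next x) ∷ U (next x) ∷ []) ≡ 3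
  -- The edge v_1v_2 sees c, u, s 1, u; an inner edge sees s t, s (t+1), s (t+1), s (t+2);
  -- the closing edge v_k v_1 sees s (k-1), c, c, u.
  count x with toℕ-next x
  count zero    | inj₁ (_ , next≡) rewrite next≡ | sym third =
    let s0≢s1 , s1≢s2 , s0≢s2 = window (s≤s (s≤s z≤n))
    in  count-xyzy (s0≢s2 , s1≢s2 ∘ sym , s0≢s1)
  count (suc y) | inj₁ (t<n , next≡) rewrite next≡ = count-xyyz (window (s≤s t<n))
  count zero    | inj₂ (() , _)
  count (suc y) | inj₂ (y≡last , next≡)
    rewrite next≡ | suc-injective y≡last | closes | starts =
    count-xyyz (last≢c , c≢u , penult)
    where
      last≢c : s (suc m) ≢ c
      last≢c e = adjacent ≤-refl (trans e (sym closes))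

  good : GoodColoring (2 + m) c u C U
  good =
      starts , refl , (next-first , prev-first) , unique , C≢U , λ x → edge-proper x , count x
    where
      next-first : C (next zero) ≢ u
      next-first e = adjacent (s≤s (s≤s z≤n)) (trans (sym (C-next zero)) (trans e (sym third)))
      prev-first : C (prev zero) ≢ u
      prev-first e = penult (trans (cong s (sym toℕ-prev-zero)) e)

-- The closed walk of length 4 + j over the letters 0, 1, 2, 3 (standing for c, u and
-- the two other colours): 0 2 1, then (0 2 1)^⌊j/3⌋, then 3 | 3 2 | 0 2 3 according
-- to j mod 3, then the closing 0.
continuation : ℕ → List (Fin 4)
continuation 0                   = # 3 ∷ # 0 ∷ []
continuation 1                   = # 3 ∷ # 2 ∷ # 0 ∷ []
continuation 2                   = # 0 ∷ # 2 ∷ # 3 ∷ # 0 ∷ []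
continuation (suc (suc (suc j))) = # 0 ∷ # 2 ∷ # 1 ∷ continuation j

walk : ℕ → List (Fin 4)
walk j = # 0 ∷ # 2 ∷ # 1 ∷ continuation j

walk-length : ∀ j → length (walk j) ≡ 5 + j
walk-length 0                   = refl
walk-length 1                   = refl
walk-length 2                   = refl
walk-length (suc (suc (suc j))) = cong (3 +_) (walk-length j)

walk-squareProper : ∀ j → SquareProper (walk j)
walk-squareProper 0 = from-yes (squareProper? (walk 0))
walk-squareProper 1 = from-yes (squareProper? (walk 1))
walk-squareProper 2 = from-yes (squareProper? (walk 2))
walk-squareProper (suc (suc (suc j))) =
    from-yes (rainbow? (# 0) (# 2) (# 1)) , from-yes (rainbow? (# 2) (# 1) (# 0))
  , from-yes (rainbow? (# 1) (# 0) (# 2)) , walk-squareProper j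

walk-closes : ∀ j → walk j ! (4 + j) ≡ # 0
walk-closes 0                   = refl
walk-closes 1                   = refl
walk-closes 2                   = refl
walk-closes (suc (suc (suc j))) = walk-closes j

walk-penult : ∀ j → walk j ! (3 + j) ≢ # 1
walk-penult 0                   = λ ()
walk-penult 1                   = λ ()
walk-penult 2                   = λ ()
walk-penult (suc (suc (suc j))) = walk-penult j

triangleLetters triangleUnique : Fin 3 → Fin 4
triangleLetters zero             = # 0
triangleLetters (suc zero)       = # 2
triangleLetters (suc (suc zero)) = # 3
triangleUnique zero    = # 1
triangleUnique (suc _) = # 0

relabel : Color → Color → Color → Color → Fin 4 → Color
relabel c u a b zero                   = c
relabel c u a b (suc zero)             = u
relabel c u a b (suc (suc zero))       = a
relabel c u a b (suc (suc (suc zero))) = b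

IsRelabelling : (Fin 4 → Color) → Set
IsRelabelling π = ∀ x y → π x ≡ π y → x ≡ y

opaque
  relabelling : ∀ c u → c ≢ u → ∃₂ λ a b → IsRelabelling (relabel c u a b)
  relabelling = from-yes (all? λ c → all? λ u → ¬? (c ≟ u) →-dec any? λ a → any? λ b →
    all? λ x → all? λ y → (relabel c u a b x ≟ relabel c u a b y) →-dec (x ≟ y))

module Relabelled {c u a b : Color} (π-relabelling : IsRelabelling (relabel c u a b)) where

  private
    π : Fin 4 → Color
    π = relabel c u a b

  π-distinct : ∀ {x y} → x ≢ y → π x ≢ π y
  π-distinct x≢y πx≡πy = x≢y (π-relabelling _ _ πx≡πy)

  π-rainbow : ∀ x y z → Rainbow x y z → Rainbow (π x) (π y) (π z)
  π-rainbow _ _ _ (x≢y , y≢z , x≢z) = π-distinct x≢y , π-distinct y≢z , π-distinct x≢z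

  walk-closedWord : ∀ j → ClosedWord (4 + j) c u (π ∘ (walk j !_))
  walk-closedWord j = record
    { starts   = refl
    ; closes   = cong π (walk-closes j)
    ; third    = refl
    ; penult   = π-distinct (walk-penult j)
    ; adjacent = λ lt → π-distinct (adjacent-distinct (walk j) sp (within (s≤s lt)))
    ; skip     = λ lt → π-distinct (skip-distinct (walk j) sp (within (s≤s lt)))
    }
    where
      sp = walk-squareProper j
      within : ∀ {i} → i < 5 + j → i < length (walk j)
      within {i} = subst (i <_) (sym (walk-length j))

  triangle-good : GoodColoring 3 c u (π ∘ triangleLetters) (π ∘ triangleUnique)
  triangle-good =
      refl , refl , (π-distinct (λ ()) , π-distinct (λ ())) , unique , C≢U , edge
    where
      unique : (w : Fin 3) → w ≢ zero →
               ExactlyOne (π (triangleLetters (prev w)) ≡ π (triangleUnique w))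
                          (π (triangleLetters (next w)) ≡ π (triangleUnique w))
      unique zero             w≢0 = ⊥-elim (w≢0 refl)
      unique (suc zero)       _   = inj₁ (refl , π-distinct (λ ()))
      unique (suc (suc zero)) _   = inj₂ (π-distinct (λ ()) , refl)
      C≢U : (w : Fin 3) → π (triangleLetters w) ≢ π (triangleUnique w)
      C≢U zero             = π-distinct (λ ())
      C≢U (suc zero)       = π-distinct (λ ())
      C≢U (suc (suc zero)) = π-distinct (λ ())
      edge : (x : Fin 3) →
             (π (triangleLetters x) ≢ π (triangleLetters (next x)))
           × (distinctCount (π (triangleLetters x) ∷ π (triangleUnique x)
                             ∷ π (triangleLetters (next x)) ∷ π (triangleUnique (next x)) ∷ []) ≡ 3)
      edge zero             = π-distinct (λ ()) ,
        count-xyzx (π-rainbow (# 0) (# 1) (# 2) ((λ ()) , (λ ()) , (λ ())))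
      edge (suc zero)       = π-distinct (λ ()) ,
        count-xyzy (π-rainbow (# 2) (# 0) (# 3) ((λ ()) , (λ ()) , (λ ())))
      edge (suc (suc zero)) = π-distinct (λ ()) ,
        count-xyyz (π-rainbow (# 3) (# 0) (# 1) ((λ ()) , (λ ()) , (λ ())))

lemma4 : (k : ℕ) .{{_ : NonZero k}} → k ≥ 3 → (c u : Color) → c ≢ u →
         Σ (Fin k → Color) (λ C → Σ (Fin k → Color) (λ U → GoodColoring k c u C U))
lemma4 (suc zero)       (s≤s ())
lemma4 (suc (suc zero)) (s≤s (s≤s ()))
lemma4 (suc (suc (suc zero))) _ c u c≢u =
  let a , b , π-relabelling = relabelling c u c≢u
      π = relabel c u a b
  in  π ∘ triangleLetters , π ∘ triangleUnique , Relabelled.triangle-good π-relabelling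
lemma4 (suc (suc (suc (suc j)))) _ c u c≢u =
  let a , b , π-relabelling = relabelling c u c≢u
      s = relabel c u a b ∘ (walk j !_)
  in  walkColouring s , successorColour u s ∘ toℕ
    , FromClosedWord.good (Relabelled.walk-closedWord π-relabelling j)
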